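{- Let $G$ be a ONE-ONE-LQ instance, $M_s$ a stable matching of $G$, and $G'$ the instance obtained by the marking construction described in the context. For any integer $k$, if $G$ admits a feasible, envy-free matching of size $k$, then $G'$ admits a feasible, envy-free matching of size $k$.
   Context: ONE-ONE-LQ instance: bipartite graph $G=(\mathcal{A}\cup\mathcal{B},E)$ of agents and resources, each vertex with a strict preference order over its neighbours ($\succ_u$), each resource with upper-quota $1$ and lower-quota in $\{0,1\}$ (LQ resource if lower-quota $1$). Matching: each vertex in at most one edge; $M(v)$ partner or $\bot$ (least preferred). Feasible: every LQ resource matched. Blocking pair $(a,b)\in E\setminus M$: $b\succ_a M(a)$ and $a\succ_b M(b)$; stable: no blocking pair. Envy: $a$ envies matched $a'$ with $M(a')=b$ if $(a,b)\in E$, $b\succ_a M(a)$, $a\succ_b a'$; envy-free: no envy. $\ell(v)$ = length of $v$'s list; $s=|M_s|$. Construction: let $X_A$ (resp. $X_B$) be the agents (resp. resources) matched in $M_s$ and $I$ the remaining vertices. Mark edges in order: (1) for every $a\in X_A$ and every LQ resource $b$ adjacent to $a$, mark $(a,b)$; (2) for every $b\in X_B$, mark the $\min(s+1,\ell(b))$ most preferred edges of $b$; (3) for every $a\in X_A$, let $C_a$ be the set of non-LQ resources $b$ in $a$'s list that also appear in the list of some $a'\in X_A$, $a'\ne a$, and mark $(a,b)$ for all $b\in C_a$; (4) for every $a\in X_A$, among the still-unmarked edges incident to $a$ (if any), mark the one to $a$'s most preferred resource. $G'$ is the ONE-ONE-LQ instance formed by the marked edges and their endpoints, with the same quotas and preference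 lists of $G$ restricted to neighbours in $G'$. -}

module Defs where

open import Data.Nat using (ℕ; suc)
open import Data.Bool using (Bool; true; false; _∧_; _∨_; not; T)
open import Data.Fin using (Fin)
open import Data.Fin.Properties using (_≟_)
open import Data.List using (List; []; _∷_; length; filterᵇ; take; null)
open import Data.Bool.ListAction using (any)
open import Data.List.Membership.Propositional using (_∈_; _∉_)
import Data.List.Membership.DecPropositional as DecMem
open import Data.List.Relation.Unary.All using (All)
open import Data.List.Relation.Unary.Unique.Propositional using (Unique)
open import Data.Product using (_×_; _,_; proj₁; proj₂; ∃; Σ)
open import Data.Maybe using (Maybe; just; nothing)
open import Relation.Nullary using (¬_; ⌊_⌋)
open import Relation.Binary.PropositionalEquality using (_≡_)

-- Each vertex has a preference list (most preferred first); the edge set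
-- is given by these lists. lq b = true iff b has lower quota 1.
-- All upper quotas are 1 (built into the notion of matching below).

record Inst (nA nB : ℕ) : Set where
  field
    prefA : Fin nA → List (Fin nB)
    prefB : Fin nB → List (Fin nA)
    lq    : Fin nB → Bool
open Inst public

WellFormed : ∀ {nA nB} → Inst nA nB → Set
WellFormed G =
  (∀ a → Unique (prefA G a)) ×
  (∀ b → Unique (prefB G b)) ×
  (∀ a b → b ∈ prefA G a → a ∈ prefB G b) ×
  (∀ a b → a ∈ prefB G b → b ∈ prefA G a)

data Pref {A : Set} (x y : A) : List A → Set where
  here  : ∀ {xs} → y ∈ xs → Pref x y (x ∷ xs)
  there : ∀ {z xs} → Pref x y xs → Pref x y (z ∷ xs)

elem : ∀ {n} → Fin n → List (Fin n) → Bool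
elem {n} x xs = ⌊ DecMem._∈?_ (_≟_ {n}) x xs ⌋

Match : ℕ → ℕ → Set
Match nA nB = List (Fin nA × Fin nB)

Edge : ∀ {nA nB} → Inst nA nB → Fin nA → Fin nB → Set
Edge G a b = b ∈ prefA G a

IsMatching : ∀ {nA nB} → Inst nA nB → Match nA nB → Set
IsMatching G M =
  All (λ e → Edge G (proj₁ e) (proj₂ e)) M ×
  Unique M ×
  (∀ a b b' → (a , b) ∈ M → (a , b') ∈ M → b ≡ b') ×
  (∀ a a' b → (a , b) ∈ M → (a' , b) ∈ M → a ≡ a')

-- b ≻_a M(a)  (M(a) = ⊥ is least preferred; b must be a neighbour of a)
PrefA : ∀ {nA nB} → Inst nA nB → Match nA nB → Fin nA → Fin nB → Set
PrefA G M a b = b ∈ prefA G a × (∀ b' → (a , b') ∈ M → Pref b b' (prefA G a))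

PrefB : ∀ {nA nB} → Inst nA nB → Match nA nB → Fin nB → Fin nA → Set
PrefB G M b a = a ∈ prefB G b × (∀ a' → (a' , b) ∈ M → Pref a a' (prefB G b))

BlockingPair : ∀ {nA nB} → Inst nA nB → Match nA nB → Fin nA → Fin nB → Set
BlockingPair G M a b =
  Edge G a b × (a , b) ∉ M × PrefA G M a b × PrefB G M b a

Stable : ∀ {nA nB} → Inst nA nB → Match nA nB → Set
Stable G M = IsMatching G M × (∀ a b → ¬ BlockingPair G M a b)

Feasible : ∀ {nA nB} → Inst nA nB → Match nA nB → Set
Feasible G M = ∀ b → T (lq G b) → ∃ λ a → (a , b) ∈ M

Envies : ∀ {nA nB} → Inst nA nB → Match nA nB → Fin nA → Fin nA → Set
Envies G M a a' = ∃ λ b →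
  (a' , b) ∈ M × Edge G a b × PrefA G M a b × Pref a a' (prefB G b)

EnvyFree : ∀ {nA nB} → Inst nA nB → Match nA nB → Set
EnvyFree G M = ∀ a a' → ¬ Envies G M a a'

module Marking {nA nB : ℕ} (G : Inst nA nB) (Ms : Match nA nB) where

  s : ℕ
  s = length Ms

  inXA : Fin nA → Bool
  inXA a = any (λ p → ⌊ proj₁ p ≟ a ⌋) Ms

  inXB : Fin nB → Bool
  inXB b = any (λ p → ⌊ proj₂ p ≟ b ⌋) Ms

  isEdge : Fin nA → Fin nB → Bool
  isEdge a b = elem b (prefA G a)

  mark1 : Fin nA → Fin nB → Bool
  mark1 a b = inXA a ∧ lq G b

  mark2 : Fin nA → Fin nB → Bool
  mark2 a b = inXB b ∧ elem a (take (suc s) (prefB G b))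

  mark3 : Fin nA → Fin nB → Bool
  mark3 a b = inXA a ∧ not (lq G b) ∧
    any (λ p → not ⌊ proj₁ p ≟ a ⌋ ∧ elem b (prefA G (proj₁ p))) Ms

  mark123 : Fin nA → Fin nB → Bool
  mark123 a b = isEdge a b ∧ (mark1 a b ∨ mark2 a b ∨ mark3 a b)

  firstUnmarked : Fin nA → Maybe (Fin nB)
  firstUnmarked a with filterᵇ (λ b → not (mark123 a b)) (prefA G a)
  ... | []     = nothing
  ... | b ∷ _  = just b

  mark4 : Fin nA → Fin nB → Bool
  mark4 a b with firstUnmarked a
  ... | nothing = false
  ... | just b' = inXA a ∧ ⌊ b ≟ b' ⌋

  marked : Fin nA → Fin nB → Bool
  marked a b = isEdge a b ∧ (mark1 a b ∨ mark2 a b ∨ mark3 a b ∨ mark4 a b)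

  -- Vertices of G
  -- that are not endpoints of marked edges get empty lists and lower
  -- quota 0, i.e. they are isolated and play no role (= absent from G').
  G' : Inst nA nB
  prefA G' a = filterᵇ (λ b → marked a b) (prefA G a)
  prefB G' b = filterᵇ (λ a → marked a b) (prefB G b)
  lq    G' b = lq G b ∧ not (null (filterᵇ (λ a → marked a b) (prefB G b)))

reduced : ∀ {nA nB} → Inst nA nB → Match nA nB → Inst nA nB
reduced G Ms = Marking.G' G Ms

{-# OPTIONS --safe #-}
module Submission where

-- Let M be a feasible envy-free matching of G.  First, every agent matched in M is
-- matched in Ms.  Call an agent a improving if its M-partner b beats its Ms-partner
-- (if any).  By stability b is held in Ms by some a' whom b prefers to a, and since a'
-- does not envy a, the M-partner of a' beats b; so a' is improving too.  The map
-- a ↦ a' is injective, hence by pigeonhole its orbit from a returns to a; as it only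
-- reaches agents matched in Ms, a is matched in Ms.
--
-- So M lives on X_A, and its LQ edges are marked in step (1).  Replace every unmarked
-- edge (a , b) of M by the edge (a , e) of step (4): e is preferred to b and, having
-- survived steps (1)-(3), is non-LQ, unmatched in Ms and on no other X_A agent's list.
-- The result is a matching of G' of the same size, feasible, and envy-free: envy for a
-- replaced resource e would put e on another X_A agent's list, and envy for a kept
-- edge is envy in M, since no agent got worse.

open import Defs
open import Data.Nat using (ℕ; suc; zero; _+_)
open import Data.Nat.Properties using (n<1+n; m≤n⇒∃[o]m+o≡n)
open import Data.Nat.GeneralisedArithmetic using (fold)
open import Data.Bool using (Bool; true; false; T; not; _∧_; _∨_; if_then_else_)
open import Data.Bool.Properties using (T-∧; T-∨)
open import Data.Bool.ListAction using (any)
open import Data.Fin using (Fin; toℕ)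
open import Data.Fin.Properties using (_≟_; pigeonhole)
open import Data.Maybe using (just; fromMaybe)
open import Data.List using ([]; _∷_; length; map; filterᵇ; take)
open import Data.List.Properties using (length-map)
open import Data.List.Membership.Propositional using (_∈_; _∉_; find; lose)
open import Data.List.Membership.Propositional.Properties using (∈-map⁺; ∈-map⁻; ∈-filter⁺; ∈-filter⁻)
open import Data.List.Relation.Unary.All as All using (All)
import Data.List.Relation.Unary.All.Properties as All
open import Data.List.Relation.Unary.AllPairs using ([]; _∷_)
open import Data.List.Relation.Unary.Any using (here; there)
open import Data.List.Relation.Unary.Any.Properties using (any⁺; any⁻; ¬Any[])
open import Data.List.Relation.Unary.Unique.Propositional using (Unique)
open import Data.Product using (Σ; _×_; _,_; proj₁; proj₂; ∃)
open import Data.Sum using (_⊎_; inj₁; inj₂; map₂)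
open import Data.Empty using (⊥-elim)
open import Function using (_∘_)
open import Function.Bundles using (_⇔_; mk⇔; Equivalence)
open Equivalence using (to; from)
open import Relation.Nullary using (¬_; Dec; yes; no; ⌊_⌋)
open import Relation.Nullary.Decidable using (T?; toWitness; fromWitness; fromWitnessFalse)
import Relation.Nullary.Decidable as Dec
open import Relation.Binary.PropositionalEquality using (_≡_; _≢_; refl; sym; trans; cong; subst)

T-∧⁺ : ∀ {x y} → T x → T y → T (x ∧ y)
T-∧⁺ p q = from T-∧ (p , q)

T-∨⁺ : ∀ {x y} → T x ⊎ T y → T (x ∨ y)
T-∨⁺ = from T-∨

T-not⁺ : ∀ {x} → ¬ T x → T (not x)
T-not⁺ {false} _  = _
T-not⁺ {true}  ¬t = ¬t _

T-not⁻ : ∀ {x} → T (not x) → ¬ T x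
T-not⁻ {false} _ ()

T-∨₃⇒∨₄ : ∀ x y z {w} → T (x ∨ y ∨ z) → T (x ∨ y ∨ z ∨ w)
T-∨₃⇒∨₄ true  _     _    _ = _
T-∨₃⇒∨₄ false true  _    _ = _
T-∨₃⇒∨₄ false false true _ = _

module _ {A : Set} where

  Pref-∈ˡ : ∀ {x y : A} {l} → Pref x y l → x ∈ l
  Pref-∈ˡ (here _)  = here refl
  Pref-∈ˡ (there p) = there (Pref-∈ˡ p)

  Pref-∈ʳ : ∀ {x y : A} {l} → Pref x y l → y ∈ l
  Pref-∈ʳ (here y∈)  = there y∈
  Pref-∈ʳ (there p) = there (Pref-∈ʳ p)

  Pref-irrefl : ∀ {x : A} {l} → Unique l → ¬ Pref x x l
  Pref-irrefl (x∉ ∷ _) (here x∈) = All.lookup x∉ x∈ refl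
  Pref-irrefl (_ ∷ u)  (there p) = Pref-irrefl u p

  Pref-≢ : ∀ {x y : A} {l} → Unique l → Pref x y l → x ≢ y
  Pref-≢ u p refl = Pref-irrefl u p

  Pref-trans : ∀ {x y z : A} {l} → Unique l → Pref x y l → Pref y z l → Pref x z l
  Pref-trans (y∉ ∷ _) (here y∈) (here _)  = ⊥-elim (All.lookup y∉ y∈ refl)
  Pref-trans _        (here _)  (there q) = here (Pref-∈ʳ q)
  Pref-trans (x∉ ∷ _) (there p) (here _)  = ⊥-elim (All.lookup x∉ (Pref-∈ʳ p) refl)
  Pref-trans (_ ∷ u)  (there p) (there q) = there (Pref-trans u p q)

  Pref-total : ∀ {x y : A} {l} → x ∈ l → y ∈ l → x ≢ y → Pref x y l ⊎ Pref y x l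
  Pref-total (here refl) (here refl) x≢y = ⊥-elim (x≢y refl)
  Pref-total (here refl) (there y∈)  _   = inj₁ (here y∈)
  Pref-total (there x∈)  (here refl) _   = inj₂ (here x∈)
  Pref-total (there x∈)  (there y∈)  x≢y with Pref-total x∈ y∈ x≢y
  ... | inj₁ p = inj₁ (there p)
  ... | inj₂ p = inj₂ (there p)

  Pref-filterᵇ⁻ : ∀ (p : A → Bool) {x y} l → Pref x y (filterᵇ p l) → Pref x y l
  Pref-filterᵇ⁻ p (z ∷ zs) q with p z
  Pref-filterᵇ⁻ p (z ∷ zs) q         | false = there (Pref-filterᵇ⁻ p zs q)
  Pref-filterᵇ⁻ p (z ∷ zs) (here y∈) | true  = here (proj₁ (∈-filter⁻ (T? ∘ p) y∈))
  Pref-filterᵇ⁻ p (z ∷ zs) (there q) | true  = there (Pref-filterᵇ⁻ p zs q)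

  filterᵇ-head : ∀ (p : A → Bool) {e es x} l → filterᵇ p l ≡ e ∷ es →
                 x ∈ l → T (p x) → e ≡ x ⊎ Pref e x l
  filterᵇ-head p (z ∷ zs) eq x∈ px with p z in pz
  filterᵇ-head p (z ∷ zs) eq   (here refl) px | false = ⊥-elim (subst T pz px)
  filterᵇ-head p (z ∷ zs) eq   (there x∈)  px | false with filterᵇ-head p zs eq x∈ px
  ... | inj₁ e≡x = inj₁ e≡x
  ... | inj₂ e≻x = inj₂ (there e≻x)
  filterᵇ-head p (z ∷ zs) refl (here refl) px | true = inj₁ refl
  filterᵇ-head p (z ∷ zs) refl (there x∈)  px | true = inj₂ (here x∈)

  ∉-take-suc : ∀ {x : A} {l} n → x ∈ l → x ∉ take (suc n) l → ∃ λ y → Pref y x l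
  ∉-take-suc n (here refl) x∉ = ⊥-elim (x∉ (here refl))
  ∉-take-suc n (there x∈)  _  = _ , here x∈

module _ {A B : Set} (f : A → B) where

  Unique-map⁺ : ∀ {xs} → (∀ {x y} → x ∈ xs → y ∈ xs → f x ≡ f y → x ≡ y) →
                Unique xs → Unique (map f xs)
  Unique-map⁺ inj []         = []
  Unique-map⁺ inj (x∉ ∷ xs!) =
    All.map⁺ (All.tabulate λ y∈ fx≡fy → All.lookup x∉ y∈ (inj (here refl) (there y∈) fx≡fy))
    ∷ Unique-map⁺ (λ x∈ y∈ → inj (there x∈) (there y∈)) xs!

module _ {S : Set} {n} (key : S → Fin n) (next : S → S)
         (key-next-injective : ∀ p q → key (next p) ≡ key (next q) → key p ≡ key q) where

  orbit-returns : ∀ p → ∃ λ m → key (fold p next (suc m)) ≡ key p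
  orbit-returns p with pigeonhole (n<1+n n) (λ i → key (fold p next (toℕ i)))
  ... | i , j , i<j , same with m≤n⇒∃[o]m+o≡n i<j
  ... | o , i+o≡j =
    o , sym (cancel (toℕ i) (subst (λ t → orbit i ≡ key (fold p next t)) (sym i+o≡j) same))
    where
      orbit : Fin (suc n) → Fin n
      orbit i = key (fold p next (toℕ i))

      cancel : ∀ i → key (fold p next i) ≡ key (fold p next (suc (i + o))) →
               key p ≡ key (fold p next (suc o))
      cancel zero    e = e
      cancel (suc i) e = cancel i (key-next-injective _ _ e)

module _ {nA nB : ℕ} (M : Match nA nB) where

  any-proj₁≟⇔ : ∀ a → T (any (λ p → ⌊ proj₁ p ≟ a ⌋) M) ⇔ (∃ λ b → (a , b) ∈ M)
  any-proj₁≟⇔ a = mk⇔ partner (λ (b , m) → any⁺ _ (lose m (fromWitness refl)))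
    where
      partner : T (any (λ p → ⌊ proj₁ p ≟ a ⌋) M) → ∃ λ b → (a , b) ∈ M
      partner t with find (any⁻ _ M t)
      ... | (x , b) , m , x≟a with toWitness x≟a
      ... | refl = b , m

  any-proj₂≟⇔ : ∀ b → T (any (λ p → ⌊ proj₂ p ≟ b ⌋) M) ⇔ (∃ λ a → (a , b) ∈ M)
  any-proj₂≟⇔ b = mk⇔ partner (λ (a , m) → any⁺ _ (lose m (fromWitness refl)))
    where
      partner : T (any (λ p → ⌊ proj₂ p ≟ b ⌋) M) → ∃ λ a → (a , b) ∈ M
      partner t with find (any⁻ _ M t)
      ... | (a , y) , m , y≟b with toWitness y≟b
      ... | refl = a , m

  matchedᴬ? : ∀ a → Dec (∃ λ b → (a , b) ∈ M)
  matchedᴬ? a = Dec.map (any-proj₁≟⇔ a) (T? _)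

  matchedᴮ? : ∀ b → Dec (∃ λ a → (a , b) ∈ M)
  matchedᴮ? b = Dec.map (any-proj₂≟⇔ b) (T? _)

module Matchings {nA nB : ℕ} (G : Inst nA nB) {M : Match nA nB} (mM : IsMatching G M) where

  matched⇒edge : ∀ {a b} → (a , b) ∈ M → b ∈ prefA G a
  matched⇒edge = All.lookup (proj₁ mM)

  partner-uniqueᴬ : ∀ {a b b'} → (a , b) ∈ M → (a , b') ∈ M → b ≡ b'
  partner-uniqueᴬ = proj₁ (proj₂ (proj₂ mM)) _ _ _

  partner-uniqueᴮ : ∀ {a a' b} → (a , b) ∈ M → (a' , b) ∈ M → a ≡ a'
  partner-uniqueᴮ = proj₂ (proj₂ (proj₂ mM)) _ _ _

module Preferences {nA nB : ℕ} {G : Inst nA nB} (wf : WellFormed G) where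

  open Matchings G

  prefA-unique : ∀ a → Unique (prefA G a)
  prefA-unique = proj₁ wf

  prefB-unique : ∀ b → Unique (prefB G b)
  prefB-unique = proj₁ (proj₂ wf)

  prefA⇒prefB : ∀ {a b} → b ∈ prefA G a → a ∈ prefB G b
  prefA⇒prefB = proj₁ (proj₂ (proj₂ wf)) _ _

  prefB⇒prefA : ∀ {a b} → a ∈ prefB G b → b ∈ prefA G a
  prefB⇒prefA = proj₂ (proj₂ (proj₂ wf)) _ _

  module _ {M : Match nA nB} (mM : IsMatching G M) where

    ¬PrefA⇒partner : ∀ {a b} → b ∈ prefA G a → ¬ PrefA G M a b →
                     ∃ λ b' → (a , b') ∈ M × (b' ≡ b ⊎ Pref b' b (prefA G a))
    ¬PrefA⇒partner {a} {b} b∈ ¬pref with matchedᴬ? M a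
    ... | no unmatched = ⊥-elim (¬pref (b∈ , λ b' m → ⊥-elim (unmatched (b' , m))))
    ... | yes (b' , m) with b' ≟ b
    ...   | yes b'≡b = b' , m , inj₁ b'≡b
    ...   | no b'≢b with Pref-total (matched⇒edge mM m) b∈ b'≢b
    ...     | inj₁ b'≻b = b' , m , inj₂ b'≻b
    ...     | inj₂ b≻b' = ⊥-elim (¬pref (b∈ , λ b'' m' →
                            subst (λ c → Pref b c (prefA G a)) (partner-uniqueᴬ mM m m') b≻b'))

    ¬PrefB⇒partner : ∀ {a b} → a ∈ prefB G b → ¬ PrefB G M b a →
                     ∃ λ a' → (a' , b) ∈ M × (a' ≡ a ⊎ Pref a' a (prefB G b))
    ¬PrefB⇒partner {a} {b} a∈ ¬pref with matchedᴮ? M b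
    ... | no unmatched = ⊥-elim (¬pref (a∈ , λ a' m → ⊥-elim (unmatched (a' , m))))
    ... | yes (a' , m) with a' ≟ a
    ...   | yes a'≡a = a' , m , inj₁ a'≡a
    ...   | no a'≢a with Pref-total (prefA⇒prefB (matched⇒edge mM m)) a∈ a'≢a
    ...     | inj₁ a'≻a = a' , m , inj₂ a'≻a
    ...     | inj₂ a≻a' = ⊥-elim (¬pref (a∈ , λ a'' m' →
                            subst (λ c → Pref a c (prefB G b)) (partner-uniqueᴮ mM m m') a≻a'))

    envyFree⇒better-partner : EnvyFree G M → ∀ {a a' b} → (a , b) ∈ M → b ∈ prefA G a' →
                              Pref a' a (prefB G b) →
                              ∃ λ b' → (a' , b') ∈ M × Pref b' b (prefA G a')
    envyFree⇒better-partner eM {a} {a'} {b} ab∈M b∈ a'≻a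
      with ¬PrefA⇒partner b∈ (λ b≻ → eM a' a (b , ab∈M , b∈ , b≻ , a'≻a))
    ... | b' , a'b'∈M , inj₂ b'≻b = b' , a'b'∈M , b'≻b
    ... | b' , a'b'∈M , inj₁ refl =
      ⊥-elim (Pref-≢ (prefB-unique b) a'≻a (partner-uniqueᴮ mM a'b'∈M ab∈M))

module Stability {nA nB : ℕ} {G : Inst nA nB} (wf : WellFormed G) {Ms : Match nA nB}
                 (st : Stable G Ms) where

  open Preferences {G = G} wf
  open Matchings G

  Ms-matching : IsMatching G Ms
  Ms-matching = proj₁ st

  stable⇒¬PrefB : ∀ {a b} → PrefA G Ms a b → ¬ PrefB G Ms b a
  stable⇒¬PrefB {a} {b} b≻ₐ a≻ᵦ =
    proj₂ st a b (proj₁ b≻ₐ , (λ ab∈ → Pref-irrefl (prefA-unique a) (proj₂ b≻ₐ b ab∈)) , b≻ₐ , a≻ᵦ)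

  stable⇒rival : ∀ {a b} → PrefA G Ms a b → ∃ λ a' → (a' , b) ∈ Ms × Pref a' a (prefB G b)
  stable⇒rival {a} {b} b≻ₐ
    with ¬PrefB⇒partner Ms-matching (prefA⇒prefB (proj₁ b≻ₐ)) (stable⇒¬PrefB b≻ₐ)
  ... | a' , a'b∈ , inj₂ a'≻a = a' , a'b∈ , a'≻a
  ... | a' , a'b∈ , inj₁ refl = ⊥-elim (Pref-irrefl (prefA-unique a) (proj₂ b≻ₐ b a'b∈))

  stable⇒preferred-matched : ∀ {a b x} → (a , b) ∈ Ms → Pref x a (prefB G b) →
                             ∃ λ c → (x , c) ∈ Ms
  stable⇒preferred-matched {a} {b} {x} ab∈ x≻a with matchedᴬ? Ms x
  ... | yes matched  = matched
  ... | no unmatched =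
    ⊥-elim (proj₂ st x b (b∈ , (λ xb∈ → unmatched (b , xb∈)) ,
                          (b∈ , λ c xc∈ → ⊥-elim (unmatched (c , xc∈))) ,
                          (Pref-∈ˡ x≻a , λ a' a'b∈ →
                            subst (λ z → Pref x z (prefB G b)) (partner-uniqueᴮ Ms-matching ab∈ a'b∈) x≻a)))
    where
      b∈ : b ∈ prefA G x
      b∈ = prefB⇒prefA (Pref-∈ˡ x≻a)

  module _ {M : Match nA nB} (mM : IsMatching G M) (eM : EnvyFree G M) where

    Improves : Fin nA → Set
    Improves a = ∃ λ b → (a , b) ∈ M × PrefA G Ms a b

    Successor : Fin nA → Fin nA → Set
    Successor a a' = ∃ λ b → (a , b) ∈ M × (a' , b) ∈ Ms

    improves-step : ∀ {a} → Improves a → ∃ λ a' → Successor a a' × Improves a'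
    improves-step (b , ab∈M , b≻ₐ) with stable⇒rival b≻ₐ
    ... | a' , a'b∈Ms , a'≻a
      with envyFree⇒better-partner mM eM ab∈M (matched⇒edge Ms-matching a'b∈Ms) a'≻a
    ... | b' , a'b'∈M , b'≻b =
      a' , (b , ab∈M , a'b∈Ms) , b' , a'b'∈M , matched⇒edge mM a'b'∈M , λ c a'c∈Ms →
        subst (λ c → Pref b' c (prefA G a')) (partner-uniqueᴬ Ms-matching a'b∈Ms a'c∈Ms) b'≻b

    successor-injective : ∀ {a x a'} → Successor a a' → Successor x a' → a ≡ x
    successor-injective (b , ab∈M , a'b∈Ms) (c , xc∈M , a'c∈Ms)
      rewrite partner-uniqueᴬ Ms-matching a'b∈Ms a'c∈Ms = partner-uniqueᴮ mM ab∈M xc∈M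

    next : Σ (Fin nA) Improves → Σ (Fin nA) Improves
    next (_ , i) = proj₁ (improves-step i) , proj₂ (proj₂ (improves-step i))

    next-successor : ∀ p → Successor (proj₁ p) (proj₁ (next p))
    next-successor (_ , i) = proj₁ (proj₂ (improves-step i))

    next-injective : ∀ p q → proj₁ (next p) ≡ proj₁ (next q) → proj₁ p ≡ proj₁ q
    next-injective p q e =
      successor-injective (next-successor p) (subst (Successor _) (sym e) (next-successor q))

    improving⇒stably-matched : ∀ p → ∃ λ c → (proj₁ p , c) ∈ Ms
    improving⇒stably-matched p with orbit-returns proj₁ next next-injective p
    ... | m , returns = subst (λ x → ∃ λ c → (x , c) ∈ Ms) returns
                          (_ , proj₂ (proj₂ (next-successor (fold p next m))))

    matched⇒stably-matched : ∀ {a b} → (a , b) ∈ M → ∃ λ c → (a , c) ∈ Ms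
    matched⇒stably-matched {a} {b} ab∈M with matchedᴬ? Ms a
    ... | yes matched  = matched
    ... | no unmatched = ⊥-elim (unmatched (improving⇒stably-matched
                           (a , b , ab∈M , matched⇒edge mM ab∈M ,
                            λ c ac∈ → ⊥-elim (unmatched (c , ac∈)))))

module Reduction {nA nB : ℕ} {G : Inst nA nB} (wf : WellFormed G) {Ms : Match nA nB}
                 (st : Stable G Ms) where

  open Preferences {G = G} wf
  open Stability {G = G} wf {Ms = Ms} st
  open Matchings G
  open Marking G Ms

  inXA⁺ : ∀ {a b} → (a , b) ∈ Ms → T (inXA a)
  inXA⁺ ab∈ = from (any-proj₁≟⇔ Ms _) (_ , ab∈)

  inXA⁻ : ∀ {a} → T (inXA a) → ∃ λ b → (a , b) ∈ Ms
  inXA⁻ = to (any-proj₁≟⇔ Ms _)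

  inXB⁺ : ∀ {a b} → (a , b) ∈ Ms → T (inXB b)
  inXB⁺ ab∈ = from (any-proj₂≟⇔ Ms _) (_ , ab∈)

  inXB⁻ : ∀ {b} → T (inXB b) → ∃ λ a → (a , b) ∈ Ms
  inXB⁻ = to (any-proj₂≟⇔ Ms _)

  mark1⁺ : ∀ {a d} → T (inXA a) → T (lq G d) → T (mark1 a d)
  mark1⁺ {a} = T-∧⁺ {inXA a}

  mark2⁺ : ∀ {a a' d} → (a' , d) ∈ Ms → a ∈ take (suc s) (prefB G d) → T (mark2 a d)
  mark2⁺ {d = d} a'd∈ a∈top = T-∧⁺ {inXB d} (inXB⁺ a'd∈) (fromWitness a∈top)

  mark3⁺ : ∀ {a d x c} → T (inXA a) → ¬ T (lq G d) → (x , c) ∈ Ms → x ≢ a → d ∈ prefA G x →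
           T (mark3 a d)
  mark3⁺ {a} {d} {x} ia non-lq xc∈ x≢a d∈x =
    T-∧⁺ {inXA a} ia (T-∧⁺ {not (lq G d)} (T-not⁺ non-lq)
      (any⁺ _ (lose xc∈ (T-∧⁺ {not ⌊ x ≟ a ⌋} (fromWitnessFalse x≢a) (fromWitness d∈x)))))

  mark4⁺ : ∀ {a e} → T (inXA a) → firstUnmarked a ≡ just e → T (mark4 a e)
  mark4⁺ {a} ia first≡e with firstUnmarked a
  mark4⁺ {a} ia refl | just _ = T-∧⁺ {inXA a} ia (fromWitness refl)

  mark123⁺ : ∀ {a d} → d ∈ prefA G a → T (mark1 a d) ⊎ T (mark2 a d) ⊎ T (mark3 a d) →
             T (mark123 a d)
  mark123⁺ {a} {d} d∈ m =
    T-∧⁺ {isEdge a d} (fromWitness d∈) (T-∨⁺ {mark1 a d} (map₂ (T-∨⁺ {mark2 a d}) m))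

  mark123⇒marked : ∀ {a b} → T (mark123 a b) → T (marked a b)
  mark123⇒marked {a} {b} t with to (T-∧ {isEdge a b}) t
  ... | b∈ , m = T-∧⁺ {isEdge a b} b∈ (T-∨₃⇒∨₄ (mark1 a b) (mark2 a b) (mark3 a b) m)

  mark4⇒marked : ∀ {a e} → e ∈ prefA G a → T (mark4 a e) → T (marked a e)
  mark4⇒marked {a} {e} e∈ m =
    T-∧⁺ {isEdge a e} (fromWitness e∈)
      (T-∨⁺ {mark1 a e} (inj₂ (T-∨⁺ {mark2 a e} (inj₂ (T-∨⁺ {mark3 a e} (inj₂ m))))))

  marked⇒edge : ∀ {a b} → T (marked a b) → b ∈ prefA G a
  marked⇒edge {a} {b} t = toWitness (proj₁ (to (T-∧ {isEdge a b}) t))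

  mark4⇒inXA : ∀ {a b} → T (mark4 a b) → T (inXA a)
  mark4⇒inXA {a} t with firstUnmarked a
  ... | just _ = proj₁ (to (T-∧ {inXA a}) t)

  marked⇒inX : ∀ {a b} → T (marked a b) → T (inXA a) ⊎ T (inXB b)
  marked⇒inX {a} {b} t with to (T-∨ {mark1 a b}) (proj₂ (to (T-∧ {isEdge a b}) t))
  ... | inj₁ m₁ = inj₁ (proj₁ (to (T-∧ {inXA a}) m₁))
  ... | inj₂ m₂₃₄ with to (T-∨ {mark2 a b}) m₂₃₄
  ...   | inj₁ m₂ = inj₂ (proj₁ (to (T-∧ {inXB b}) m₂))
  ...   | inj₂ m₃₄ with to (T-∨ {mark3 a b}) m₃₄
  ...     | inj₁ m₃ = inj₁ (proj₁ (to (T-∧ {inXA a}) m₃))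
  ...     | inj₂ m₄ = inj₁ (mark4⇒inXA m₄)

  Leftover : Fin nA → Fin nB → Set
  Leftover a d = d ∈ prefA G a × ¬ T (mark123 a d)

  module _ {a : Fin nA} (ia : T (inXA a)) where

    leftover-nonLQ : ∀ {d} → Leftover a d → ¬ T (lq G d)
    leftover-nonLQ (d∈ , ¬m) lq-d = ¬m (mark123⁺ d∈ (inj₁ (mark1⁺ ia lq-d)))

    leftover-private : ∀ {d x} → Leftover a d → T (inXA x) → x ≢ a → d ∉ prefA G x
    leftover-private l@(d∈ , ¬m) ix x≢a d∈x =
      ¬m (mark123⁺ d∈ (inj₂ (inj₂ (mark3⁺ ia (leftover-nonLQ l) (proj₂ (inXA⁻ ix)) x≢a d∈x))))

    leftover-unmatched : ∀ {d} → Leftover a d → ∀ a' → (a' , d) ∉ Ms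
    -- If Ms matches d to a itself, a is not at the head of d's list; by stability the
    -- head is matched in Ms, so it is another X_A agent with d on its list.
    leftover-unmatched {d} l a' a'd∈ with a' ≟ a
    ... | no a'≢a = leftover-private l (inXA⁺ a'd∈) a'≢a (matched⇒edge Ms-matching a'd∈)
    ... | yes refl with ∉-take-suc s (prefA⇒prefB (proj₁ l)) (λ a∈top →
                          proj₂ l (mark123⁺ (proj₁ l) (inj₂ (inj₁ (mark2⁺ a'd∈ a∈top)))))
    ... | x , x≻a with stable⇒preferred-matched a'd∈ x≻a
    ... | _ , xc∈ =
      leftover-private l (inXA⁺ xc∈) (Pref-≢ (prefB-unique d) x≻a) (prefB⇒prefA (Pref-∈ˡ x≻a))

    leftover-marked⇒inXA : ∀ {x d} → Leftover a d → T (marked x d) → T (inXA x)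
    leftover-marked⇒inXA l t with marked⇒inX t
    ... | inj₁ ix = ix
    ... | inj₂ id = ⊥-elim (leftover-unmatched l _ (proj₂ (inXB⁻ id)))

  first-leftover : ∀ {a d} → Leftover a d →
                   ∃ λ e → firstUnmarked a ≡ just e × Leftover a e × (e ≡ d ⊎ Pref e d (prefA G a))
  first-leftover {a} {d} (d∈ , ¬m) with filterᵇ (λ b → not (mark123 a b)) (prefA G a) in eq
  ... | [] =
    ⊥-elim (¬Any[] (subst (d ∈_) eq (∈-filter⁺ (T? ∘ λ b → not (mark123 a b)) d∈ (T-not⁺ ¬m))))
  ... | e ∷ _ with ∈-filter⁻ (T? ∘ λ b → not (mark123 a b)) (subst (e ∈_) (sym eq) (here refl))
  ... | e∈ , ¬me = e , refl , (e∈ , T-not⁻ ¬me) , filterᵇ-head _ (prefA G a) eq d∈ (T-not⁺ ¬m)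

  -- The default of fromMaybe is never used: an unmarked edge guarantees a step-(4) edge.
  redirect : Fin nA → Fin nB → Fin nB
  redirect a b = if marked a b then b else fromMaybe b (firstUnmarked a)

  Upgrade : Fin nA → Fin nB → Fin nB → Set
  Upgrade a b e = Leftover a e × Pref e b (prefA G a)

  redirect-marked : ∀ {a b} → T (marked a b) → redirect a b ≡ b
  redirect-marked {a} {b} t with marked a b
  ... | true = refl

  redirect-unmarked : ∀ {a b e} → ¬ T (marked a b) → firstUnmarked a ≡ just e → redirect a b ≡ e
  redirect-unmarked {a} {b} ¬t first≡e with marked a b
  ... | true  = ⊥-elim (¬t _)
  ... | false rewrite first≡e = refl

  redirect-spec : ∀ {a b} → T (inXA a) → b ∈ prefA G a →
                  T (marked a (redirect a b)) × (redirect a b ≡ b ⊎ Upgrade a b (redirect a b))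
  redirect-spec {a} {b} ia b∈ with T? (marked a b)
  ... | yes mab rewrite redirect-marked mab = mab , inj₁ refl
  ... | no ¬mab with first-leftover (b∈ , ¬mab ∘ mark123⇒marked)
  ... | e , first≡e , l , e⪰b rewrite redirect-unmarked ¬mab first≡e = mae , inj₂ (l , e≻b e⪰b)
    where
      mae : T (marked a e)
      mae = mark4⇒marked (proj₁ l) (mark4⁺ ia first≡e)
      e≻b : e ≡ b ⊎ Pref e b (prefA G a) → Pref e b (prefA G a)
      e≻b (inj₁ refl) = ⊥-elim (¬mab mae)
      e≻b (inj₂ p)    = p

  marked⇒edge′ : ∀ {a b} → T (marked a b) → b ∈ prefA G' a
  marked⇒edge′ {a} t = ∈-filter⁺ (T? ∘ marked a) (marked⇒edge t) t

  edge′⇒marked : ∀ {a b} → b ∈ prefA G' a → T (marked a b)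
  edge′⇒marked {a} b∈ = proj₂ (∈-filter⁻ (T? ∘ marked a) {xs = prefA G a} b∈)

  Pref′⇒Prefᴬ : ∀ {a b b'} → Pref b b' (prefA G' a) → Pref b b' (prefA G a)
  Pref′⇒Prefᴬ {a} = Pref-filterᵇ⁻ (marked a) (prefA G a)

  Pref′⇒Prefᴮ : ∀ {b a a'} → Pref a a' (prefB G' b) → Pref a a' (prefB G b)
  Pref′⇒Prefᴮ {b} = Pref-filterᵇ⁻ (λ a → marked a b) (prefB G b)

  lq′⇒lq : ∀ {b} → T (lq G' b) → T (lq G b)
  lq′⇒lq {b} t = proj₁ (to (T-∧ {lq G b}) t)

  module Rerouting {M : Match nA nB} (mM : IsMatching G M) (fM : Feasible G M)
                   (eM : EnvyFree G M) where

    matched⇒inXA : ∀ {a b} → (a , b) ∈ M → T (inXA a)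
    matched⇒inXA ab∈ = inXA⁺ (proj₂ (matched⇒stably-matched mM eM ab∈))

    reroute : Fin nA × Fin nB → Fin nA × Fin nB
    reroute (a , b) = a , redirect a b

    M' : Match nA nB
    M' = map reroute M

    rerouted : ∀ {a b} → (a , b) ∈ M →
               T (marked a (redirect a b)) × (redirect a b ≡ b ⊎ Upgrade a b (redirect a b))
    rerouted ab∈ = redirect-spec (matched⇒inXA ab∈) (matched⇒edge mM ab∈)

    ∈-M'⁻ : ∀ {a e} → (a , e) ∈ M' → ∃ λ b → (a , b) ∈ M × e ≡ redirect a b
    ∈-M'⁻ ae∈ with ∈-map⁻ reroute ae∈
    ... | (_ , b) , ab∈ , refl = b , ab∈ , refl

    M'-partner : ∀ {a e} → (a , e) ∈ M' →
                 ∃ λ b → (a , b) ∈ M × T (marked a e) × (e ≡ b ⊎ Upgrade a b e)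
    M'-partner ae∈ with ∈-M'⁻ ae∈
    ... | b , ab∈ , refl = b , ab∈ , rerouted ab∈

    reroute-injective : ∀ {x y} → x ∈ M → y ∈ M → reroute x ≡ reroute y → x ≡ y
    reroute-injective {a , b} {a' , b'} ab∈ a'b'∈ eq with cong proj₁ eq
    ... | refl = cong (a ,_) (partner-uniqueᴬ mM ab∈ a'b'∈)

    M'-partner-uniqueᴬ : ∀ a e₁ e₂ → (a , e₁) ∈ M' → (a , e₂) ∈ M' → e₁ ≡ e₂
    M'-partner-uniqueᴬ a _ _ ae₁∈ ae₂∈ with ∈-M'⁻ ae₁∈ | ∈-M'⁻ ae₂∈
    ... | b₁ , ab₁∈ , refl | b₂ , ab₂∈ , refl = cong (redirect a) (partner-uniqueᴬ mM ab₁∈ ab₂∈)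

    M'-partner-uniqueᴮ : ∀ a₁ a₂ e → (a₁ , e) ∈ M' → (a₂ , e) ∈ M' → a₁ ≡ a₂
    M'-partner-uniqueᴮ a₁ a₂ e a₁e∈ a₂e∈ with a₁ ≟ a₂ | M'-partner a₁e∈ | M'-partner a₂e∈
    ... | yes a₁≡a₂ | _ | _ = a₁≡a₂
    ... | no a₁≢a₂ | _ , a₁b₁∈ , t₁ , _ | _ , a₂b₂∈ , _ , inj₂ (l₂ , _) =
      ⊥-elim (leftover-private (matched⇒inXA a₂b₂∈) l₂ (matched⇒inXA a₁b₁∈) a₁≢a₂
                               (marked⇒edge t₁))
    ... | no a₁≢a₂ | _ , a₁b₁∈ , _ , inj₂ (l₁ , _) | _ , a₂b₂∈ , t₂ , inj₁ _ =
      ⊥-elim (leftover-private (matched⇒inXA a₁b₁∈) l₁ (matched⇒inXA a₂b₂∈) (a₁≢a₂ ∘ sym)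
                               (marked⇒edge t₂))
    ... | no _ | _ , a₁b₁∈ , _ , inj₁ refl | _ , a₂b₂∈ , _ , inj₁ refl =
      partner-uniqueᴮ mM a₁b₁∈ a₂b₂∈

    M'-matching : IsMatching G' M'
    M'-matching =
      All.tabulate (λ ae∈ → marked⇒edge′ (proj₁ (proj₂ (proj₂ (M'-partner ae∈))))) ,
      Unique-map⁺ reroute reroute-injective (proj₁ (proj₂ mM)) ,
      M'-partner-uniqueᴬ ,
      M'-partner-uniqueᴮ

    LQ-kept : ∀ {a b} → (a , b) ∈ M → T (lq G b) → redirect a b ≡ b
    LQ-kept ab∈ lq-b = redirect-marked (mark123⇒marked
      (mark123⁺ (matched⇒edge mM ab∈) (inj₁ (mark1⁺ (matched⇒inXA ab∈) lq-b))))

    M'-feasible : Feasible G' M'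
    M'-feasible b lq′ with fM b (lq′⇒lq lq′)
    ... | a , ab∈ = a , subst (λ e → (a , e) ∈ M') (LQ-kept ab∈ (lq′⇒lq lq′)) (∈-map⁺ reroute ab∈)

    M'-envyFree : EnvyFree G' M'
    M'-envyFree x y (e , ye∈ , e∈′ , (_ , e≻M'x) , x≻′y) with M'-partner ye∈
    ... | b , yb∈ , _ , inj₁ refl = eM x y (b , yb∈ , b∈ , (b∈ , b≻Mx) , Pref′⇒Prefᴮ x≻′y)
      where
        b∈ : b ∈ prefA G x
        b∈ = marked⇒edge (edge′⇒marked e∈′)
        b≻Mx : ∀ b' → (x , b') ∈ M → Pref b b' (prefA G x)
        b≻Mx b' xb'∈ with Pref′⇒Prefᴬ (e≻M'x _ (∈-map⁺ reroute xb'∈)) | proj₂ (rerouted xb'∈)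
        ... | b≻r | inj₁ r≡b' = subst (λ c → Pref b c (prefA G x)) r≡b' b≻r
        ... | b≻r | inj₂ (_ , r≻b') = Pref-trans (prefA-unique x) b≻r r≻b'
    ... | b , yb∈ , _ , inj₂ (l , _) =
      leftover-private iy l (leftover-marked⇒inXA iy l (edge′⇒marked e∈′))
        (Pref-≢ (prefB-unique e) (Pref′⇒Prefᴮ x≻′y)) (marked⇒edge (edge′⇒marked e∈′))
      where
        iy : T (inXA y)
        iy = matched⇒inXA yb∈

lemma3 : ∀ {nA nB} (G : Inst nA nB) → WellFormed G →
    (Ms : Match nA nB) → Stable G Ms → (k : ℕ) →
    (∃ λ M → IsMatching G M × Feasible G M × EnvyFree G M × length M ≡ k) →
    ∃ λ M → IsMatching (reduced G Ms) M × Feasible (reduced G Ms) M ×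
            EnvyFree (reduced G Ms) M × length M ≡ k
lemma3 G wf Ms st k (M , mM , fM , eM , |M|≡k) =
  M' , M'-matching , M'-feasible , M'-envyFree , trans (length-map reroute M) |M|≡k
  where open Reduction.Rerouting {G = G} wf {Ms = Ms} st {M = M} mM fM eM
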